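{- Let $P$ be a poset such that $\{q\in P:q\le p\}$ is finite for every $p\in P$. Let $(A_p)_{p\in P}$, $(B_p)_{p\in P}$ be families of finite sets, write $A_{\le p}=\sum_{q\le p}A_q\subseteq \sum_{q\in P}A_q$ and similarly $B_{\le p}$, and let $\pi_A:\sum_p A_p\to P$, $\pi_B:\sum_pB_p\to P$ be the projections ($\pi_A(x)=p\iff x\in A_p$, and likewise for $B$). Suppose that for each $p\in P$, $g_p:A_{\le p}\to B_{\le p}$ is a bijection. Define $F(p,x)$ for $x\in A_{\le p}$ and $\bar F(p,x)$ for $x\in B_{\le p}$ by the mutual recursion \[F(p,x):\; y:=g_p(x),\ q:=\pi_B(y);\ \text{return } y \text{ if } q=p,\ \text{else return } F\bigl(p,\bar F(q,y)\bigr);\] \[\bar F(p,x):\; y:=g_p^{ -1}(x),\ q:=\pi_A(y);\ \text{return } y \text{ if } q=p,\ \text{else return } \bar F\bigl(p,F(q,y)\bigr).\] Then for every $p\in P$, the map $f_p(x)=F(p,x)$ is well defined (the recursion terminates) on $A_p$ and is a bijection $f_p:A_p\to B_p$.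
   Context: $\sum$ denotes disjoint union. -}

module Defs where

open import Data.Product using (Σ; _,_; proj₁; proj₂; _×_)
open import Data.Fin using (Fin)
open import Data.Nat using (ℕ)
open import Function.Bundles using (_↔_; Inverse)
open import Relation.Binary.PropositionalEquality using (_≡_; _≢_)
open import Relation.Binary.Structures using (IsPartialOrder)

IsFinite : Set → Set
IsFinite X = Σ ℕ λ n → X ↔ Fin n

IsPropRel : {P : Set} → (P → P → Set) → Set
IsPropRel _≤_ = ∀ {p q} (u v : p ≤ q) → u ≡ v

module Recursion {P : Set} (_≤_ : P → P → Set)
                 (isPO : IsPartialOrder _≡_ _≤_) (A B : P → Set) where

  open IsPartialOrder isPO using () renaming (refl to ≤-refl)

  -- X_{≤p} = Σ_{q ≤ p} X_q, as the subset of Σ_q X_q of elements x with π(x) ≤ p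
  Below : (P → Set) → P → Set
  Below X p = Σ (Σ P X) λ x → proj₁ x ≤ p

  A≤ B≤ : P → Set
  A≤ = Below A
  B≤ = Below B

  module Rec (g : ∀ p → A≤ p ↔ B≤ p) where

    gto : ∀ p → A≤ p → B≤ p
    gto p = Inverse.to (g p)

    gfrom : ∀ p → B≤ p → A≤ p
    gfrom p = Inverse.from (g p)

    -- Graphs of the mutually recursive procedures F and F̄.
    -- A derivation is exactly a finite run of the recursion.
    data F : (p : P) → A≤ p → Σ P B → Set
    data F̄ : (p : P) → B≤ p → Σ P A → Set

    data F where
      F-stop : ∀ p x → proj₁ (proj₁ (gto p x)) ≡ p
             → F p x (proj₁ (gto p x))
      F-step : ∀ p x → proj₁ (proj₁ (gto p x)) ≢ p
             → (z : Σ P A)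
             → F̄ (proj₁ (proj₁ (gto p x))) (proj₁ (gto p x) , ≤-refl) z
             → (le : proj₁ z ≤ p)
             → (w : Σ P B) → F p (z , le) w
             → F p x w

    data F̄ where
      F̄-stop : ∀ p x → proj₁ (proj₁ (gfrom p x)) ≡ p
             → F̄ p x (proj₁ (gfrom p x))
      F̄-step : ∀ p x → proj₁ (proj₁ (gfrom p x)) ≢ p
             → (z : Σ P B)
             → F (proj₁ (proj₁ (gfrom p x))) (proj₁ (gfrom p x) , ≤-refl) z
             → (le : proj₁ z ≤ p)
             → (w : Σ P A) → F̄ p (z , le) w
             → F̄ p x w

{-# OPTIONS --safe #-}
-- Induct on p along the strict order, which is well founded because down-sets are finite,
-- proving at each level that F(p,-) and F̄(p,-) are total on A_p and B_p and undo each other.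
-- At level p a run of F from x ∈ A_p is an orbit in the finite set A_{≤p} of the hop
-- x ↦ F̄(q, g_p x) (q the level of g_p x, q ≠ p). By the induction hypothesis F̄(q,-) is
-- undone by F(q,-), so hops are injective; and no hop lands on a point of level p. An
-- injective orbit in a finite set starting at a point without predecessor cannot cycle, so
-- F(p,x) terminates. Retracing the orbit backwards is a run of F̄(p,-) from F(p,x) to x,
-- and since runs are deterministic the two maps are mutually inverse.
module Submission where

open import Defs
open import Data.Empty using (⊥; ⊥-elim)
open import Data.Fin using (Fin; zero; suc; toℕ; _≟_)
open import Data.Fin.Properties using (+↔⊎; pigeonhole; toℕ≤pred[n]; injective⇒≤)
open import Data.Nat using (ℕ; zero; suc; _+_; _<_; _≤_; z≤n; s≤s)
open import Data.Nat.Induction using (<-wellFounded)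
open import Data.Nat.Properties using (<-irrefl; <⇒≤; ≤-<-trans; m≤n⇒m<n∨m≡n; +-suc; +-identityʳ; n<1+n)
open import Data.Product using (Σ; ∃; _,_; proj₁; proj₂; _×_)
open import Data.Product.Function.Dependent.Propositional using (Σ-↔)
open import Data.Sum using (_⊎_; inj₁; inj₂)
open import Data.Sum.Function.Propositional using (_⊎-↔_)
open import Function using (_∘_; flip)
open import Function.Bundles using (_↔_; Inverse; Injection; mk↔ₛ′)
open import Function.Construct.Identity using (↔-id)
open import Function.Definitions using (Injective; Bijective)
open import Function.Properties.Inverse using (↔-sym; ↔-trans; Inverse⇒Injection)
open import Induction.WellFounded using (Acc; acc; WellFounded; module Subrelation; module All)
open import Level using (Level)
import Relation.Binary.Construct.On as On
open import Relation.Binary.Definitions using (DecidableEquality)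
open import Relation.Binary.PropositionalEquality
  using (_≡_; _≢_; refl; sym; trans; cong; subst; module ≡-Reasoning)
open import Relation.Binary.Structures using (IsPartialOrder)
open import Relation.Nullary.Decidable using (Dec; yes; no; map′; via-injection)
open import Relation.Nullary.Negation using (¬_)

Σ-Fin-suc↔ : ∀ {n} {C : Fin (suc n) → Set} → Σ (Fin (suc n)) C ↔ (C zero ⊎ Σ (Fin n) (C ∘ suc))
Σ-Fin-suc↔ = mk↔ₛ′ split join (λ { (inj₁ _) → refl ; (inj₂ _) → refl })
                             (λ { (zero , _) → refl ; (suc _ , _) → refl })
  where
  split : Σ (Fin _) _ → _ ⊎ _
  split (zero , c) = inj₁ c
  split (suc i , c) = inj₂ (i , c)
  join : _ ⊎ _ → Σ (Fin _) _
  join (inj₁ c) = zero , c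
  join (inj₂ (i , c)) = suc i , c

Σ-Fin-finite : ∀ n {C : Fin n → Set} → (∀ i → IsFinite (C i)) → IsFinite (Σ (Fin n) C)
Σ-Fin-finite zero    _   = 0 , mk↔ₛ′ (λ ()) (λ ()) (λ ()) (λ ())
Σ-Fin-finite (suc n) fin with fin zero | Σ-Fin-finite n (fin ∘ suc)
... | k , e | m , e′ = k + m , ↔-trans Σ-Fin-suc↔ (↔-trans (e ⊎-↔ e′) (↔-sym +↔⊎))

Σ-finite : ∀ {I : Set} {C : I → Set} → IsFinite I → (∀ i → IsFinite (C i)) → IsFinite (Σ I C)
Σ-finite (n , e) fin with Σ-Fin-finite n (fin ∘ Inverse.from e)
... | m , e′ = m , ↔-trans (↔-sym (Σ-↔ (↔-sym e) (↔-id _))) e′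

finite⇒decEq : ∀ {X : Set} → IsFinite X → DecidableEquality X
finite⇒decEq (_ , e) = via-injection (Inverse⇒Injection e) _≟_

module FiniteOrbit {ℓ : Level} {X : Set} (finite : IsFinite X) (_↦_ : X → X → Set ℓ)
                   (↦-injective : ∀ {x x′ y} → x ↦ y → x′ ↦ y → x ≡ x′)
                   (x₀ : X) (x₀-source : ∀ {x} → ¬ (x ↦ x₀)) where

  data Path : ℕ → X → Set ℓ where
    []  : Path 0 x₀
    _▸_ : ∀ {k x y} → Path k x → x ↦ y → Path (suc k) y

  length-unique : ∀ {i j x} → Path i x → Path j x → i ≡ j
  length-unique []      []       = refl
  length-unique []      (_ ▸ s)  = ⊥-elim (x₀-source s)
  length-unique (_ ▸ s) []       = ⊥-elim (x₀-source s)
  length-unique (π ▸ s) (π′ ▸ s′) with ↦-injective s s′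
  ... | refl = cong suc (length-unique π π′)

  prefix : ∀ {k x} → Path k x → ∀ i → i ≤ k → ∃ (Path i)
  prefix []      _ z≤n = x₀ , []
  prefix (π ▸ s) i i≤k with m≤n⇒m<n∨m≡n i≤k
  ... | inj₁ (s≤s i≤k′) = prefix π i i≤k′
  ... | inj₂ refl       = _ , π ▸ s

  vertex : ∀ {k x} → Path k x → proj₁ finite < k → (i : Fin (suc (proj₁ finite))) → ∃ (Path (toℕ i))
  vertex π n<k i = prefix π (toℕ i) (<⇒≤ (≤-<-trans (toℕ≤pred[n] i) n<k))

  no-long-path : ∀ {k x} → Path k x → proj₁ finite < k → ⊥
  no-long-path π n<k
    with i , j , i<j , same ← pigeonhole (n<1+n _) (Inverse.to (proj₂ finite) ∘ proj₁ ∘ vertex π n<k)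
    with vertex π n<k i | vertex π n<k j | Injection.injective (Inverse⇒Injection (proj₂ finite)) same
  ... | _ , πᵢ | _ , πⱼ | refl = <-irrefl (length-unique πᵢ πⱼ) i<j

  accessible-along : ∀ m {k x} → Path k x → proj₁ finite < k + m → Acc (flip _↦_) x
  accessible-along zero    {k} π n<k rewrite +-identityʳ k = ⊥-elim (no-long-path π n<k)
  accessible-along (suc m) {k} π n<k+1+m =
    acc λ s → accessible-along m (π ▸ s) (subst (proj₁ finite <_) (+-suc k m) n<k+1+m)

  terminates : Acc (flip _↦_) x₀
  terminates = accessible-along (suc (proj₁ finite)) [] (n<1+n _)

proj₁-injective : ∀ {A : Set} {B : A → Set} → (∀ {a} (u v : B a) → u ≡ v)
                → {u v : Σ A B} → proj₁ u ≡ proj₁ v → u ≡ v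
proj₁-injective irr {a , u} {.a , v} refl = cong (a ,_) (irr u v)

,-injectiveʳ : ∀ {A : Set} {B : A → Set} {a} {u v : B a} → _≡_ {A = Σ A B} (a , u) (a , v) → u ≡ v
,-injectiveʳ refl = refl

module _ {P : Set} {_≼_ : P → P → Set} (isPO : IsPartialOrder _≡_ _≼_) where

  open IsPartialOrder isPO using (antisym) renaming (refl to ≼-refl; trans to ≼-trans)

  Down : P → Set
  Down p = Σ P λ q → q ≼ p

  Below : (P → Set) → P → Set
  Below X p = Σ (Σ P X) λ x → proj₁ x ≼ p

  Hop : (P → Set) → (P → Set) → Set
  Hop X Y = ∀ p → Below X p → Below Y p

  -- F is Run A B g g⁻¹ and F̄ is Run B A g⁻¹ g, so each fact about runs is proved once.
  data Run (X Y : P → Set) (to : Hop X Y) (from : Hop Y X) : (p : P) → Below X p → Σ P Y → Set where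
    stop : ∀ p x → proj₁ (proj₁ (to p x)) ≡ p → Run X Y to from p x (proj₁ (to p x))
    step : ∀ p x → proj₁ (proj₁ (to p x)) ≢ p → (z : Σ P X)
         → Run Y X from to (proj₁ (proj₁ (to p x))) (proj₁ (to p x) , ≼-refl) z
         → (z≼p : proj₁ z ≼ p) → (w : Σ P Y) → Run X Y to from p (z , z≼p) w
         → Run X Y to from p x w

  Run-level : ∀ {X Y to from p x w} → Run X Y to from p x w → proj₁ w ≡ p
  Run-level (stop _ _ q≡p)         = q≡p
  Run-level (step _ _ _ _ _ _ _ r) = Run-level r

  stop-via : ∀ {X Y to from p x y} → to p x ≡ y → proj₁ (proj₁ y) ≡ p → Run X Y to from p x (proj₁ y)
  stop-via refl = stop _ _

  step-via : ∀ {X Y to from p x y w} → to p x ≡ y → proj₁ (proj₁ y) ≢ p → (z : Σ P X)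
           → Run Y X from to (proj₁ (proj₁ y)) (proj₁ y , ≼-refl) z
           → (z≼p : proj₁ z ≼ p) → Run X Y to from p (z , z≼p) w
           → Run X Y to from p x w
  step-via refl q≢p z d z≼p r = step _ _ q≢p z d z≼p _ r

  Total : (X Y : P → Set) → Hop X Y → Hop Y X → P → Set
  Total X Y to from q = ∀ a → Σ (Y q) λ b → Run X Y to from q ((q , a) , ≼-refl) (q , b)

  Reversible : (X Y : P → Set) → Hop X Y → Hop Y X → P → Set
  Reversible X Y to from q =
    ∀ a b → Run X Y to from q ((q , a) , ≼-refl) (q , b) → Run Y X from to q ((q , b) , ≼-refl) (q , a)

  record Solved (X Y : P → Set) (to : Hop X Y) (from : Hop Y X) (q : P) : Set where
    field
      total       : Total X Y to from q
      total⁻      : Total Y X from to q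
      reversible  : Reversible X Y to from q
      reversible⁻ : Reversible Y X from to q

  Solved-swap : ∀ {X Y to from q} → Solved X Y to from q → Solved Y X from to q
  Solved-swap s = record { total = total⁻ ; total⁻ = total ; reversible = reversible⁻ ; reversible⁻ = reversible }
    where open Solved s

  module _ {A B : P → Set} (g : ∀ p → Below A p ↔ Below B p) where

    open Recursion _≼_ isPO A B using (module Rec)
    open Rec g

    F⇒Run : ∀ {p x w} → F p x w → Run A B gto gfrom p x w
    F̄⇒Run : ∀ {p x w} → F̄ p x w → Run B A gfrom gto p x w
    F⇒Run (F-stop p x q≡p)             = stop p x q≡p
    F⇒Run (F-step p x q≢p z d z≼p w r) = step p x q≢p z (F̄⇒Run d) z≼p w (F⇒Run r)
    F̄⇒Run (F̄-stop p x q≡p)             = stop p x q≡p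
    F̄⇒Run (F̄-step p x q≢p z d z≼p w r) = step p x q≢p z (F⇒Run d) z≼p w (F̄⇒Run r)

    Run⇒F : ∀ {p x w} → Run A B gto gfrom p x w → F p x w
    Run⇒F̄ : ∀ {p x w} → Run B A gfrom gto p x w → F̄ p x w
    Run⇒F (stop p x q≡p)             = F-stop p x q≡p
    Run⇒F (step p x q≢p z d z≼p w r) = F-step p x q≢p z (Run⇒F̄ d) z≼p w (Run⇒F r)
    Run⇒F̄ (stop p x q≡p)             = F̄-stop p x q≡p
    Run⇒F̄ (step p x q≢p z d z≼p w r) = F̄-step p x q≢p z (Run⇒F d) z≼p w (Run⇒F̄ r)

  module _ (≼-irrelevant : IsPropRel _≼_) where

    Run-deterministic : ∀ {X Y to from p x w w′} → Run X Y to from p x w → Run X Y to from p x w′ → w ≡ w′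
    Run-deterministic (stop _ _ _)             (stop _ _ _)                = refl
    Run-deterministic (stop _ _ q≡p)           (step _ _ q≢p _ _ _ _ _)    = ⊥-elim (q≢p q≡p)
    Run-deterministic (step _ _ q≢p _ _ _ _ _) (stop _ _ q≡p)              = ⊥-elim (q≢p q≡p)
    Run-deterministic (step _ _ _ _ d z≼p _ r) (step _ _ _ _ d′ z≼p′ _ r′)
      with Run-deterministic d d′
    ... | refl with ≼-irrelevant z≼p z≼p′
    ... | refl = Run-deterministic r r′

    total-bijective : ∀ {X Y to from q} (s : Solved X Y to from q) → Bijective _≡_ _≡_ (proj₁ ∘ Solved.total s)
    total-bijective s = injective , surjective
      where
      open Solved s
      injective : ∀ {a a′} → proj₁ (total a) ≡ proj₁ (total a′) → a ≡ a′
      injective {a} {a′} same with reversible a _ (proj₂ (total a)) | reversible a′ _ (proj₂ (total a′))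
      ... | back | back′ rewrite same = ,-injectiveʳ (Run-deterministic back back′)
      surjective : ∀ b → Σ _ λ a → ∀ {a′} → a′ ≡ a → proj₁ (total a′) ≡ b
      surjective b = proj₁ (total⁻ b) , λ { refl →
        ,-injectiveʳ (Run-deterministic (proj₂ (total _)) (reversible⁻ b _ (proj₂ (total⁻ b)))) }

    module _ (down-finite : ∀ p → IsFinite (Down p)) where

      ≡-dec-below : ∀ {p q} → q ≼ p → Dec (q ≡ p)
      ≡-dec-below {p} {q} q≼p =
        map′ (cong proj₁) (proj₁-injective ≼-irrelevant) (finite⇒decEq (down-finite p) (q , q≼p) (p , ≼-refl))

      size : P → ℕ
      size p = proj₁ (down-finite p)

      _⊏_ : P → P → Set
      q ⊏ p = q ≼ p × q ≢ p

      size-mono : ∀ {p q} → q ⊏ p → size q < size p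
      size-mono {p} {q} (q≼p , q≢p) = injective⇒≤ {f = embed} embed-injective
        where
        code : ∀ r → Down r → Fin (size r)
        code r = Inverse.to (proj₂ (down-finite r))
        decode : Fin (size q) → Down q
        decode = Inverse.from (proj₂ (down-finite q))
        widen : Down q → Down p
        widen (r , r≼q) = r , ≼-trans r≼q q≼p
        embed : Fin (suc (size q)) → Fin (size p)
        embed zero    = code p (p , ≼-refl)
        embed (suc i) = code p (widen (decode i))
        code-injective : ∀ r → Injective _≡_ _≡_ (code r)
        code-injective r = Injection.injective (Inverse⇒Injection (proj₂ (down-finite r)))
        decode-injective : Injective _≡_ _≡_ decode
        decode-injective = Injection.injective (Inverse⇒Injection (↔-sym (proj₂ (down-finite q))))
        top-not-widened : ∀ i → p ≢ proj₁ (decode i)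
        top-not-widened i p≡r = q≢p (antisym q≼p (subst (_≼ q) (sym p≡r) (proj₂ (decode i))))
        embed-injective : Injective _≡_ _≡_ embed
        embed-injective {zero}  {zero}  _  = refl
        embed-injective {zero}  {suc j} eq = ⊥-elim (top-not-widened j (cong proj₁ (code-injective p eq)))
        embed-injective {suc i} {zero}  eq = ⊥-elim (top-not-widened i (cong proj₁ (code-injective p (sym eq))))
        embed-injective {suc i} {suc j} eq =
          cong suc (decode-injective (proj₁-injective ≼-irrelevant (cong proj₁ (code-injective p eq))))

      ⊏-wellFounded : WellFounded _⊏_
      ⊏-wellFounded = Subrelation.wellFounded size-mono (On.wellFounded size <-wellFounded)

      Below-finite : ∀ {X : P → Set} → (∀ q → IsFinite (X q)) → ∀ p → IsFinite (Below X p)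
      Below-finite {X} X-finite p with Σ-finite (down-finite p) (X-finite ∘ proj₁)
      ... | n , e = n , ↔-trans regroup e
        where
        regroup : Below X p ↔ Σ (Down p) (X ∘ proj₁)
        regroup = mk↔ₛ′ (λ ((q , a) , q≼p) → (q , q≼p) , a) (λ ((q , q≼p) , a) → (q , a) , q≼p)
                        (λ _ → refl) (λ _ → refl)

      module Inductive-step {X Y : P → Set} {to : Hop X Y} {from : Hop Y X}
                  (from∘to : ∀ p x → from p (to p x) ≡ x) (X-finite : ∀ q → IsFinite (X q))
                  (p : P) (IH : ∀ {q} → q ⊏ p → Solved X Y to from q) where

        open FiniteOrbit using (terminates)

        start : X p → Below X p
        start a = (p , a) , ≼-refl

        reverse-below : (y : Σ P Y) → proj₁ y ⊏ p → ∀ {z}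
                      → Run Y X from to (proj₁ y) (y , ≼-refl) z → Run X Y to from (proj₁ z) (z , ≼-refl) y
        reverse-below (q , b) q⊏p {r , a} d with Run-level d
        ... | refl = Solved.reversible⁻ (IH q⊏p) b a d

        record _↦_ (x x′ : Below X p) : Set where
          constructor detour
          field
            leaves  : proj₁ (proj₁ (to p x)) ≢ p
            returns : Run Y X from to (proj₁ (proj₁ (to p x))) (proj₁ (to p x) , ≼-refl) (proj₁ x′)

        ↦-injective : ∀ {x x′ z} → x ↦ z → x′ ↦ z → x ≡ x′
        ↦-injective {x} {x′} (detour q≢p d) (detour q′≢p d′) = begin
          x                ≡⟨ sym (from∘to p x) ⟩
          from p (to p x)  ≡⟨ cong (from p) (proj₁-injective ≼-irrelevant same-hop) ⟩
          from p (to p x′) ≡⟨ from∘to p x′ ⟩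
          x′               ∎
          where
          open ≡-Reasoning
          same-hop : proj₁ (to p x) ≡ proj₁ (to p x′)
          same-hop = Run-deterministic (reverse-below _ (proj₂ (to p x) , q≢p) d)
                                       (reverse-below _ (proj₂ (to p x′) , q′≢p) d′)

        start-source : ∀ {a x} → ¬ (x ↦ start a)
        start-source (detour q≢p d) = q≢p (sym (Run-level d))

        run : ∀ x → Acc (flip _↦_) x → Σ (Σ P Y) (Run X Y to from p x)
        run x (acc rec) with ≡-dec-below (proj₂ (to p x))
        ... | yes q≡p = _ , stop p x q≡p
        ... | no  q≢p with Solved.total⁻ (IH (proj₂ (to p x) , q≢p)) (proj₂ (proj₁ (to p x)))
        ...   | a , d with run ((_ , a) , proj₂ (to p x)) (rec (detour q≢p d))
        ...     | w , r = w , step p x q≢p _ d (proj₂ (to p x)) w r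

        total : Total X Y to from p
        total a with run (start a) (terminates (Below-finite {X} X-finite p) _↦_ ↦-injective (start a) start-source)
        ... | (q , b) , r with Run-level r
        ... | refl = b , r

        retrace : ∀ {x w₀ w} → Run X Y to from p x w₀ → Run Y X from to p (to p x) w
                → (w₀≼p : proj₁ w₀ ≼ p) → Run Y X from to p (w₀ , w₀≼p) w
        retrace {x} (stop _ _ _) back w₀≼p with ≼-irrelevant w₀≼p (proj₂ (to p x))
        ... | refl = back
        retrace {x} (step _ _ q≢p z d z≼p _ r) back =
          retrace r (step-via (from∘to p (z , z≼p)) z≢p _ reversed (proj₂ (to p x)) back)
          where
          reversed : Run X Y to from (proj₁ z) (z , ≼-refl) (proj₁ (to p x))
          reversed = reverse-below _ (proj₂ (to p x) , q≢p) d
          z≢p : proj₁ z ≢ p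
          z≢p z≡p = q≢p (trans (sym (Run-level d)) z≡p)

        reversible : Reversible X Y to from p
        reversible a b r = retrace r (stop-via (from∘to p (start a)) refl) ≼-refl

      solved : ∀ {X Y to from}
             → (∀ p y → to p (from p y) ≡ y) → (∀ p x → from p (to p x) ≡ x)
             → (∀ q → IsFinite (X q)) → (∀ q → IsFinite (Y q))
             → ∀ p → Solved X Y to from p
      solved to∘from from∘to X-finite Y-finite = All.wfRec ⊏-wellFounded _ (Solved _ _ _ _) λ p IH → record
        { total       = Inductive-step.total      from∘to X-finite p IH
        ; total⁻      = Inductive-step.total      to∘from Y-finite p (Solved-swap ∘ IH)
        ; reversible  = Inductive-step.reversible from∘to X-finite p IH
        ; reversible⁻ = Inductive-step.reversible to∘from Y-finite p (Solved-swap ∘ IH)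
        }

proposition8 : (P : Set) (_≤_ : P → P → Set) (isPO : IsPartialOrder _≡_ _≤_)
    → IsPropRel _≤_
    → (∀ p → IsFinite (Σ P λ q → q ≤ p))
    → (A B : P → Set)
    → (∀ p → IsFinite (A p)) → (∀ p → IsFinite (B p))
    → (g : ∀ p → Recursion.A≤ _≤_ isPO A B p ↔ Recursion.B≤ _≤_ isPO A B p)
    → ∀ p → Σ (A p → B p) λ f →
        (∀ a → Recursion.Rec.F _≤_ isPO A B g p ((p , a) , IsPartialOrder.refl isPO) (p , f a))
      × (∀ a y → Recursion.Rec.F _≤_ isPO A B g p ((p , a) , IsPartialOrder.refl isPO) y → y ≡ (p , f a))
      × Bijective _≡_ _≡_ f
proposition8 P _≤_ isPO ≤-irrelevant down-finite A B A-finite B-finite g p =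
  proj₁ ∘ total ,
  (λ a → Run⇒F isPO g (proj₂ (total a))) ,
  (λ a y run → Run-deterministic isPO ≤-irrelevant (F⇒Run isPO g run) (proj₂ (total a))) ,
  total-bijective isPO ≤-irrelevant solution
  where
  solution : Solved isPO A B (Inverse.to ∘ g) (Inverse.from ∘ g) p
  solution = solved isPO ≤-irrelevant down-finite
               (λ q → Inverse.strictlyInverseˡ (g q)) (λ q → Inverse.strictlyInverseʳ (g q)) A-finite B-finite p
  open Solved solution
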